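{- Let $q,n,r,t$ be integers with $n,r\geq 1$, $q\geq 2$ and $1\leq t\leq nr$, and let $X$, $\mathcal{S}$, $\mathcal{F}$, $\mathcal{S}'$, $\mathcal{F}'$, the functions $\phi_a$ and the space $V$ be as defined in the context. Then the set $\{\phi_b : b\in\mathcal{F}'\}$ spans $V$ over $\mathbb{Q}$.
   Context: Write $[m]=\{1,\dots,m\}$. Let $X$ be the set of all functions $[nr]\to[q]$. Partition $[nr]$ into $n$ blocks of $r$ consecutive integers (the $i$-th block is $\{(i-1)r+1,\dots,ir\}$). Let $\mathcal{S}$ be the family of $t$-subsets $S\subseteq[nr]$ such that, for some integers $t_1,\dots,t_n\in\{0,1,\dots,r\}$ with $t_1+\dots+t_n=t$, $S$ consists of the first $t_i$ elements of the $i$-th block for each $i$. Let $\mathcal{F}$ be the set of all functions $a\colon S\to[q]$ with $S\in\mathcal{S}$. For any function $a\colon T\to[q]$ with $T\subseteq[nr]$, define $\phi_a\colon X\to\mathbb{Q}$ by $\phi_a(x)=1$ if $x(i)=a(i)$ for all $i\in T$ and $\phi_a(x)=0$ otherwise. Let $V$ be the $\mathbb{Q}$-linear span of $\{\phi_a:a\in\mathcal{F}\}$. Let $\mathcal{S}'$ be the family of all sets $T$ with $T\subseteq S$ for some $S\in\mathcal{S}$, and let $\mathcal{F}'$ be the set of all functions $b\colon T\to[q-1]$ with $T\in\mathcal{S}'$. -}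

module Defs where

open import Data.Nat using (ℕ; zero; suc; _*_; _≤_; _<_; _<?_)
open import Data.Fin using (Fin; toℕ; remQuot) renaming (_≟_ to _≟ᶠ_)
open import Data.Bool using (Bool; true; false; not; _∨_; if_then_else_)
open import Data.List using (List; allFin; map; foldr)
open import Data.Bool.ListAction using (all)
open import Data.Nat.ListAction using (sum)
open import Data.List.Relation.Unary.All using (All)
open import Data.Product using (Σ; _×_; _,_; proj₁; proj₂)
open import Data.Rational using (ℚ; 0ℚ; 1ℚ) renaming (_+_ to _+ℚ_; _*_ to _*ℚ_)
open import Relation.Nullary.Decidable using (⌊_⌋)
open import Relation.Binary.PropositionalEquality using (_≡_)

-- Positions of [nr] are encoded as Fin (n * r) (0-based); the colour set [q] as Fin q.
-- Position p lies in block i with offset j where remQuot {n} r p = (i , j), i.e. p = i*r + j.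

X : ℕ → ℕ → ℕ → Set
X n r q = Fin (n * r) → Fin q

Subset : ℕ → ℕ → Set
Subset n r = Fin (n * r) → Bool

sumℚ : List ℚ → ℚ
sumℚ = foldr _+ℚ_ 0ℚ

Admissible : (n r t : ℕ) → (Fin n → ℕ) → Set
Admissible n r t tv = ((i : Fin n) → tv i ≤ r) × (sum (map tv (allFin n)) ≡ t)

-- the set S ∈ 𝒮 determined by (t₁,…,tₙ): the first tᵢ elements of block i
prefixSet : (n r : ℕ) → (Fin n → ℕ) → Subset n r
prefixSet n r tv p = ⌊ toℕ (proj₂ (remQuot {n} r p)) <? tv (proj₁ (remQuot {n} r p)) ⌋

-- φ_a for a : T → [q]; a is given as a total function whose values outside T are ignored
agrees : {n r q : ℕ} → Subset n r → (Fin (n * r) → Fin q) → X n r q → Bool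
agrees {n} {r} T a x = all (λ p → not (T p) ∨ ⌊ a p ≟ᶠ x p ⌋) (allFin (n * r))

φ : {n r q : ℕ} → Subset n r → (Fin (n * r) → Fin q) → X n r q → ℚ
φ {n} {r} {q} T a x = if agrees {n} {r} {q} T a x then 1ℚ else 0ℚ

-- Index set for 𝒮: admissible (t₁,…,tₙ); 𝓕 is indexed by (tv , a) with a : S → [q]
FIndex : (n r q t : ℕ) → Set
FIndex n r q t = Σ (Fin n → ℕ) (λ tv → Admissible n r t tv × (Fin (n * r) → Fin q))

φF : {n r q t : ℕ} → FIndex n r q t → X n r q → ℚ
φF {n} {r} {q} (tv , _ , a) = φ {n} {r} {q} (prefixSet n r tv) a

-- 𝓕' : functions b : T → [q-1] with T ⊆ S for some S ∈ 𝒮.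
-- [q-1] ⊆ [q] is encoded as the elements of Fin q with toℕ < q - 1.
F'Index : (n r q t : ℕ) → Set
F'Index n r q t =
  Σ (Subset n r) (λ T →
  Σ (Fin (n * r) → Fin q) (λ b →
    Σ (Fin n → ℕ) (λ tv → Admissible n r t tv ×
        ((p : Fin (n * r)) → T p ≡ true → prefixSet n r tv p ≡ true)) ×
    ((p : Fin (n * r)) → T p ≡ true → suc (toℕ (b p)) < q)))

φF' : {n r q t : ℕ} → F'Index n r q t → X n r q → ℚ
φF' {n} {r} {q} (T , b , _) = φ {n} {r} {q} T b

InSpan : {n r q : ℕ} {I : Set} → (I → X n r q → ℚ) → (X n r q → ℚ) → Set
InSpan {n} {r} {q} {I} gen f =
  Σ (List (ℚ × I)) λ L →
    (x : X n r q) → f x ≡ sumℚ (map (λ ci → proj₁ ci *ℚ gen (proj₂ ci) x) L)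

module Submission where

-- Both inclusions rest on one pointwise identity between the indicators φ_a.
-- If p ∉ dom a, then Σ_c [x p = c] = 1 gives φ_a = Σ_c φ_{a ∪ {p ↦ c}}; iterating over
-- S ∖ T writes φ_b (b ∈ 𝓕', T ⊆ S) as a sum of φ_a with a : S → [q].  Conversely, for
-- p ∈ dom a the same identity for a restricted away from p gives
-- φ_a = φ_{a ∖ p} − Σ_{c ≠ a p} φ_{a[p ↦ c]}; when a p is the top colour q every term on
-- the right has one top-coloured position fewer and the same or smaller domain, so
-- iterating over the positions of S writes φ_a (a ∈ 𝓕) as a combination of φ_b with b
-- taking values in [q-1].

open import Defs
open import Data.Nat using (ℕ; zero; suc; _*_; _≤_; _<_; _<?_; s≤s; s≤s⁻¹)
open import Data.Nat.Properties using (≤-antisym; ≮⇒≥; ≤∧≢⇒<)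
import Data.Fin as Fin
open import Data.Fin using (Fin; toℕ; punchIn) renaming (_≟_ to _≟ᶠ_)
open import Data.Fin.Properties using (toℕ<n; toℕ-injective; punchInᵢ≢i)
open import Data.Bool using (Bool; true; false; not; _∨_; T; if_then_else_)
open import Data.Unit using (tt)
open import Data.List using (List; []; _∷_; _++_; map; allFin)
open import Data.List.Properties using (map-∘)
open import Data.List.Membership.Propositional using (_∈_)
open import Data.List.Membership.Propositional.Properties using (∈-allFin)
open import Data.List.Relation.Unary.Any using (here; there)
import Data.List.Relation.Unary.All as All
open import Data.List.Relation.Unary.All.Properties using (all⁺; all⁻)
open import Data.Vec.Functional using (Vector; updateAt)
open import Data.Vec.Functional.Properties using (updateAt-updates; updateAt-minimal; updateAt-id-local; updateAt-updateAt-local)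
open import Data.Product using (Σ; _×_; _,_; proj₁; proj₂; map₁; map₂)
open import Data.Sum using (_⊎_; inj₁; inj₂)
open import Data.Rational using (ℚ; 0ℚ; 1ℚ; -_; _-_) renaming (_+_ to _+ℚ_; _*_ to _*ℚ_)
open import Data.Rational.Properties using (+-identityˡ; +-identityʳ; *-identityˡ; *-zeroˡ; *-zeroʳ; +-assoc; *-assoc; *-distribˡ-+; +-*-commutativeRing)
open import Data.Rational.Solver using (module +-*-Solver)
open import Algebra.Bundles using (CommutativeRing)
open import Algebra.Properties.Semiring.Sum (CommutativeRing.semiring +-*-commutativeRing)
  using (sum; sum-syntax; sum-cong-≗; sum-remove; sum-replicate-zero; *-distribʳ-sum)
open import Function using (_∘_; id; const)
open import Level using (0ℓ)
open import Relation.Unary using (Pred)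
open import Relation.Nullary using (¬_; Dec; yes; no; does; contradiction)
open import Relation.Nullary.Decidable using (⌊_⌋)
open import Relation.Binary.PropositionalEquality using (_≡_; _≢_; _≗_; refl; sym; trans; cong; cong₂; subst; module ≡-Reasoning)

open ≡-Reasoning

combination : {A I : Set} → (I → A → ℚ) → List (ℚ × I) → A → ℚ
combination gen L x = sumℚ (map (λ ci → proj₁ ci *ℚ gen (proj₂ ci) x) L)

Span : {A I : Set} → (I → A → ℚ) → (A → ℚ) → Set
Span {A} gen f = Σ (List (ℚ × _)) λ L → (x : A) → f x ≡ combination gen L x

module _ {A I : Set} {gen : I → A → ℚ} where

  combination-++ : ∀ L M x → combination gen (L ++ M) x ≡ combination gen L x +ℚ combination gen M x
  combination-++ [] M x = sym (+-identityˡ _)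
  combination-++ ((c , i) ∷ L) M x =
    trans (cong (c *ℚ gen i x +ℚ_) (combination-++ L M x)) (sym (+-assoc (c *ℚ gen i x) _ _))

  combination-scale : ∀ k L x → combination gen (map (map₁ (k *ℚ_)) L) x ≡ k *ℚ combination gen L x
  combination-scale k [] x = sym (*-zeroʳ k)
  combination-scale k ((c , i) ∷ L) x = begin
    k *ℚ c *ℚ gen i x +ℚ combination gen (map (map₁ (k *ℚ_)) L) x
      ≡⟨ cong₂ _+ℚ_ (*-assoc k c _) (combination-scale k L x) ⟩
    k *ℚ (c *ℚ gen i x) +ℚ k *ℚ combination gen L x
      ≡⟨ *-distribˡ-+ k _ _ ⟨
    k *ℚ combination gen ((c , i) ∷ L) x ∎

  span-resp : {f g : A → ℚ} → f ≗ g → Span gen g → Span gen f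
  span-resp f≗g (L , g≗L) = L , λ x → trans (f≗g x) (g≗L x)

  span-gen : ∀ i → Span gen (gen i)
  span-gen i = (1ℚ , i) ∷ [] , λ x → sym (trans (+-identityʳ _) (*-identityˡ _))

  span-+ : {f g : A → ℚ} → Span gen f → Span gen g → Span gen (λ x → f x +ℚ g x)
  span-+ (L , f≗L) (M , g≗M) =
    L ++ M , λ x → trans (cong₂ _+ℚ_ (f≗L x) (g≗M x)) (sym (combination-++ L M x))

  span-scale : ∀ k {f : A → ℚ} → Span gen f → Span gen (λ x → k *ℚ f x)
  span-scale k (L , f≗L) =
    map (map₁ (k *ℚ_)) L , λ x → trans (cong (k *ℚ_) (f≗L x)) (sym (combination-scale k L x))

  span-− : {f g : A → ℚ} → Span gen f → Span gen g → Span gen (λ x → f x - g x)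
  span-− {f} {g} sf sg = span-resp minus (span-+ sf (span-scale (- 1ℚ) sg))
    where
    open +-*-Solver
    minus : ∀ x → f x - g x ≡ f x +ℚ - 1ℚ *ℚ g x
    minus x = solve 2 (λ u v → u :- v := u :+ con (- 1ℚ) :* v) refl (f x) (g x)

  span-∑ : ∀ {k} (f : Fin k → A → ℚ) → (∀ c → Span gen (f c)) → Span gen (λ x → ∑[ c < k ] f c x)
  span-∑ {zero} f sf = [] , λ x → refl
  span-∑ {suc k} f sf = span-+ (sf Fin.zero) (span-∑ (f ∘ Fin.suc) (sf ∘ Fin.suc))

span-reindex : {A I J : Set} {gen : I → A → ℚ} {f : A → ℚ} (ι : J → I) → Span (gen ∘ ι) f → Span gen f
span-reindex ι (L , f≗L) = map (map₂ ι) L , λ x → trans (f≗L x) (cong sumℚ (map-∘ L))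

δ : ∀ {k} → Fin k → Fin k → ℚ
δ c d = if does (c ≟ᶠ d) then 1ℚ else 0ℚ

δ-≡ : ∀ {k} {c d : Fin k} → c ≡ d → δ c d ≡ 1ℚ
δ-≡ {c = c} {d} c≡d with c ≟ᶠ d
... | yes _ = refl
... | no c≢d = contradiction c≡d c≢d

δ-≢ : ∀ {k} {c d : Fin k} → c ≢ d → δ c d ≡ 0ℚ
δ-≢ {c = c} {d} c≢d with c ≟ᶠ d
... | yes c≡d = contradiction c≡d c≢d
... | no _ = refl

∑-δ : ∀ {k} (d : Fin k) → ∑[ c < k ] δ c d ≡ 1ℚ
∑-δ {suc k} d = begin
  ∑[ c < suc k ] δ c d                   ≡⟨ sum-remove {i = d} (λ c → δ c d) ⟩
  δ d d +ℚ ∑[ j < k ] δ (punchIn d j) d  ≡⟨ cong₂ _+ℚ_ (δ-≡ {c = d} refl) (sum-cong-≗ {k} (λ j → δ-≢ (punchInᵢ≢i d j))) ⟩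
  1ℚ +ℚ sum {k} (const 0ℚ)              ≡⟨ cong (1ℚ +ℚ_) (sum-replicate-zero k) ⟩
  1ℚ +ℚ 0ℚ                              ≡⟨ +-identityʳ 1ℚ ⟩
  1ℚ                                    ∎

_[_]≔_ : ∀ {A : Set} {N} → Vector A N → Fin N → A → Vector A N
xs [ i ]≔ y = updateAt xs i (const y)

infix 5 _[_]≔_
infix 4 _∈ᵇ_ _⊆_

_∈ᵇ_ : ∀ {N} → Fin N → Vector Bool N → Set
p ∈ᵇ W = W p ≡ true

_⊆_ : ∀ {N} → Vector Bool N → Vector Bool N → Set
U ⊆ W = ∀ p → p ∈ᵇ U → p ∈ᵇ W

module _ {N : ℕ} where

  ∉ᵇ : {W : Vector Bool N} {p : Fin N} → W p ≡ false → ¬ p ∈ᵇ W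
  ∉ᵇ W[p]≡false p∈W = contradiction (trans (sym p∈W) W[p]≡false) λ ()

  insert-⊆ : {U W : Vector Bool N} {p : Fin N} → U ⊆ W → p ∈ᵇ W → U [ p ]≔ true ⊆ W
  insert-⊆ {U} {p = p} U⊆W p∈W p′ p′∈U⁺ with p′ ≟ᶠ p
  ... | yes refl = p∈W
  ... | no p′≢p = U⊆W p′ (trans (sym (updateAt-minimal p′ p U p′≢p)) p′∈U⁺)

  ⊆-insert : {W : Vector Bool N} {p : Fin N} → W ⊆ W [ p ]≔ true
  ⊆-insert {W} {p} p′ p′∈W with p′ ≟ᶠ p
  ... | yes refl = updateAt-updates p W
  ... | no p′≢p = trans (updateAt-minimal p′ p W p′≢p) p′∈W

  remove-⊆ : {W : Vector Bool N} {p : Fin N} → W [ p ]≔ false ⊆ W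
  remove-⊆ {W} {p} p′ p′∈W⁻ with p′ ≟ᶠ p
  ... | yes refl = contradiction p′∈W⁻ (∉ᵇ {W = W [ p ]≔ false} (updateAt-updates p W))
  ... | no p′≢p = trans (sym (updateAt-minimal p′ p W p′≢p)) p′∈W⁻

  remove-insert : {W : Vector Bool N} {p : Fin N} → p ∈ᵇ W → (W [ p ]≔ false) [ p ]≔ true ≗ W
  remove-insert {W} {p} p∈W p′ =
    trans (updateAt-updateAt-local p {h = id} W (sym p∈W) p′) (updateAt-id-local p W refl p′)

  _⊆_∪_ : Pred (Fin N) 0ℓ → Pred (Fin N) 0ℓ → List (Fin N) → Set
  Q ⊆ G ∪ P = ∀ x → Q x → G x ⊎ x ∈ P

  ⊆∪-[] : {Q G : Pred (Fin N) 0ℓ} → Q ⊆ G ∪ [] → ∀ x → Q x → G x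
  ⊆∪-[] Q⊆G x Qx with Q⊆G x Qx
  ... | inj₁ Gx = Gx

  ⊆∪-uncons : {Q G Q′ G′ : Pred (Fin N) 0ℓ} {p : Fin N} {P : List (Fin N)} →
              Q ⊆ G ∪ (p ∷ P) → (Q′ p → G′ p) → (∀ x → x ≢ p → Q′ x → Q x × (G x → G′ x)) →
              Q′ ⊆ G′ ∪ P
  ⊆∪-uncons {p = p} Q⊆G∪pP at-p off-p x Q′x with x ≟ᶠ p
  ... | yes refl = inj₁ (at-p Q′x)
  ... | no x≢p with off-p x x≢p Q′x
  ...   | Qx , G⇒G′ with Q⊆G∪pP x Qx
  ...     | inj₁ Gx = inj₁ (G⇒G′ Gx)
  ...     | inj₂ (here x≡p) = contradiction x≡p x≢p
  ...     | inj₂ (there x∈P) = inj₂ x∈P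

module Indicators (n r q : ℕ) where

  Φ : Subset n r → X n r q → X n r q → ℚ
  Φ = φ {n} {r} {q}

  Agrees : Subset n r → X n r q → X n r q → Set
  Agrees W a x = ∀ p → p ∈ᵇ W → a p ≡ x p

  private
    clause-sound : ∀ s {P : Set} (P? : Dec P) → T (not s ∨ ⌊ P? ⌋) → s ≡ true → P
    clause-sound true (yes p) _ _ = p

    clause-complete : ∀ s {P : Set} (P? : Dec P) → (s ≡ true → P) → T (not s ∨ ⌊ P? ⌋)
    clause-complete false P? _ = tt
    clause-complete true (yes _) _ = tt
    clause-complete true (no ¬p) s⇒p = ¬p (s⇒p refl)

    bool-ext : ∀ {b c} → (T b → T c) → (T c → T b) → b ≡ c
    bool-ext {false} {false} _ _ = refl
    bool-ext {false} {true} _ c⇒b = contradiction (c⇒b tt) λ ()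
    bool-ext {true} {false} b⇒c _ = contradiction (b⇒c tt) λ ()
    bool-ext {true} {true} _ _ = refl

  agrees-sound : ∀ {W a x} → T (agrees {n} {r} {q} W a x) → Agrees W a x
  agrees-sound {W} {a} {x} h p =
    clause-sound (W p) (a p ≟ᶠ x p) (All.lookup (all⁺ _ (allFin (n * r)) h) (∈-allFin p))

  agrees-complete : ∀ {W a x} → Agrees W a x → T (agrees {n} {r} {q} W a x)
  agrees-complete {W} {a} {x} h = all⁻ _ {allFin (n * r)} (All.tabulate λ {p} _ → clause-complete (W p) (a p ≟ᶠ x p) (h p))

  Φ-cong : ∀ {W W′ a a′ x} → (Agrees W a x → Agrees W′ a′ x) → (Agrees W′ a′ x → Agrees W a x) →
           Φ W a x ≡ Φ W′ a′ x
  Φ-cong to from = cong (λ b → if b then 1ℚ else 0ℚ)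
    (bool-ext (agrees-complete ∘ to ∘ agrees-sound) (agrees-complete ∘ from ∘ agrees-sound))

  Φ-disagree : ∀ {W a x} → ¬ Agrees W a x → Φ W a x ≡ 0ℚ
  Φ-disagree {W} {a} {x} ¬agree with agrees {n} {r} {q} W a x in eq
  ... | true = contradiction (agrees-sound (subst T (sym eq) tt)) ¬agree
  ... | false = refl

  Φ-same-domain : ∀ {U W : Subset n r} {a} → U ⊆ W → W ⊆ U → Φ U a ≗ Φ W a
  Φ-same-domain U⊆W W⊆U x = Φ-cong (λ agree p → agree p ∘ W⊆U p) (λ agree p → agree p ∘ U⊆W p)

  Φ-local : ∀ {W : Subset n r} {a a′} → (∀ p → p ∈ᵇ W → a p ≡ a′ p) → Φ W a ≗ Φ W a′
  Φ-local a≡a′ x =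
    Φ-cong (λ agree p p∈W → trans (sym (a≡a′ p p∈W)) (agree p p∈W))
           (λ agree p p∈W → trans (a≡a′ p p∈W) (agree p p∈W))

  Φ-insert : ∀ {W a x p} → W p ≡ false → Φ (W [ p ]≔ true) a x ≡ δ (a p) (x p) *ℚ Φ W a x
  Φ-insert {W} {a} {x} {p} p∉W = by-cases (a p ≟ᶠ x p)
    where
    by-cases : Dec (a p ≡ x p) → Φ (W [ p ]≔ true) a x ≡ δ (a p) (x p) *ℚ Φ W a x
    by-cases (yes ap≡xp) = begin
      Φ (W [ p ]≔ true) a x      ≡⟨ Φ-cong (λ agree p′ → agree p′ ∘ ⊆-insert {W = W} p′) extend ⟩
      Φ W a x                    ≡⟨ *-identityˡ (Φ W a x) ⟨
      1ℚ *ℚ Φ W a x              ≡⟨ cong (_*ℚ Φ W a x) (δ-≡ ap≡xp) ⟨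
      δ (a p) (x p) *ℚ Φ W a x   ∎
      where
      extend : Agrees W a x → Agrees (W [ p ]≔ true) a x
      extend agree p′ p′∈W⁺ with p′ ≟ᶠ p
      ... | yes refl = ap≡xp
      ... | no p′≢p = agree p′ (trans (sym (updateAt-minimal p′ p W p′≢p)) p′∈W⁺)
    by-cases (no ap≢xp) = begin
      Φ (W [ p ]≔ true) a x      ≡⟨ Φ-disagree {W [ p ]≔ true} (λ agree → ap≢xp (agree p (updateAt-updates p W))) ⟩
      0ℚ                         ≡⟨ *-zeroˡ (Φ W a x) ⟨
      0ℚ *ℚ Φ W a x              ≡⟨ cong (_*ℚ Φ W a x) (δ-≢ ap≢xp) ⟨
      δ (a p) (x p) *ℚ Φ W a x   ∎

  Φ-split : ∀ {W a x p} → W p ≡ false → Φ W a x ≡ ∑[ c < q ] Φ (W [ p ]≔ true) (a [ p ]≔ c) x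
  Φ-split {W} {a} {x} {p} p∉W = sym (begin
    ∑[ c < q ] Φ (W [ p ]≔ true) (a [ p ]≔ c) x  ≡⟨ sum-cong-≗ {q} term ⟩
    ∑[ c < q ] (δ c (x p) *ℚ Φ W a x)            ≡⟨ *-distribʳ-sum (Φ W a x) (λ c → δ c (x p)) ⟨
    (∑[ c < q ] δ c (x p)) *ℚ Φ W a x            ≡⟨ cong (_*ℚ Φ W a x) (∑-δ (x p)) ⟩
    1ℚ *ℚ Φ W a x                                ≡⟨ *-identityˡ _ ⟩
    Φ W a x                                      ∎)
    where
    term : ∀ c → Φ (W [ p ]≔ true) (a [ p ]≔ c) x ≡ δ c (x p) *ℚ Φ W a x
    term c = trans (Φ-insert p∉W)
      (cong₂ _*ℚ_ (cong (λ d → δ d (x p)) (updateAt-updates p a))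
                  (Φ-local (λ p′ p′∈W → updateAt-minimal p′ p a λ { refl → ∉ᵇ {W = W} p∉W p′∈W }) x))

  Φ-∈-span-extensions : (S : Subset n r) (P : List (Fin (n * r))) {U : Subset n r} (b : X n r q) →
                        U ⊆ S → (_∈ᵇ S) ⊆ (_∈ᵇ U) ∪ P → Span (Φ S) (Φ U b)
  Φ-∈-span-extensions S [] b U⊆S S⊆U∪[] =
    span-resp (Φ-same-domain U⊆S (⊆∪-[] S⊆U∪[])) (span-gen b)
  Φ-∈-span-extensions S (p ∷ P) {U} b U⊆S S⊆U∪pP with S p in S[p] | U p in U[p]
  ... | false | _ = Φ-∈-span-extensions S P b U⊆S
    (⊆∪-uncons S⊆U∪pP (λ p∈S → contradiction p∈S (∉ᵇ {W = S} S[p])) λ _ _ x∈S → x∈S , id)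
  ... | true | true = Φ-∈-span-extensions S P b U⊆S
    (⊆∪-uncons S⊆U∪pP (λ _ → U[p]) λ _ _ x∈S → x∈S , id)
  ... | true | false = span-resp (λ x → Φ-split U[p]) (span-∑ _ λ c →
    Φ-∈-span-extensions S P (b [ p ]≔ c) (insert-⊆ U⊆S S[p])
      (⊆∪-uncons S⊆U∪pP (λ _ → updateAt-updates p U)
        λ x x≢p x∈S → x∈S , trans (updateAt-minimal x p U x≢p)))

BelowTop : ∀ {q} → Fin q → Set
BelowTop {q} c = suc (toℕ c) < q

below-top? : ∀ {q} (c : Fin q) → Dec (BelowTop c)
below-top? {q} c = suc (toℕ c) <? q

below-top-of-≢ : ∀ {m} {c d : Fin (suc m)} → ¬ BelowTop d → c ≢ d → BelowTop c
below-top-of-≢ {m} {c} {d} d-top c≢d =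
  s≤s (≤∧≢⇒< (s≤s⁻¹ (toℕ<n c)) λ c≡m → c≢d (toℕ-injective (trans c≡m (sym d≡m))))
  where
  d≡m : toℕ d ≡ m
  d≡m = ≤-antisym (s≤s⁻¹ (toℕ<n d)) (s≤s⁻¹ (≮⇒≥ d-top))

module TopColour (n r m : ℕ) where
  open Indicators n r (suc m)

  Reduced : Subset n r → X n r (suc m) → Set
  Reduced W b = ∀ p → p ∈ᵇ W → BelowTop (b p)

  ReducedIn : Subset n r → Set
  ReducedIn S = Σ (Subset n r) λ W → Σ (X n r (suc m)) λ b → W ⊆ S × Reduced W b

  Φ-reduced : (S : Subset n r) → ReducedIn S → X n r (suc m) → ℚ
  Φ-reduced S (W , b , _) = Φ W b

  Φ-exclude : ∀ {W a x p} → p ∈ᵇ W →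
              Φ W a x ≡ Φ (W [ p ]≔ false) a x - ∑[ j < m ] Φ W (a [ p ]≔ punchIn (a p) j) x
  Φ-exclude {W} {a} {x} {p} p∈W = begin
    Φ W a x                    ≡⟨ solve 2 (λ u v → u := u :+ v :- v) refl (Φ W a x) others ⟩
    Φ W a x +ℚ others - others ≡⟨ cong (_- others) removed ⟨
    Φ W⁻ a x - others          ∎
    where
    open +-*-Solver
    W⁻ : Subset n r
    W⁻ = W [ p ]≔ false
    others : ℚ
    others = ∑[ j < m ] Φ W (a [ p ]≔ punchIn (a p) j) x
    restore : ∀ {a′} → Φ (W⁻ [ p ]≔ true) a′ x ≡ Φ W a′ x
    restore = Φ-same-domain (λ p′ → subst (_≡ true) (remove-insert p∈W p′))
                            (λ p′ → subst (_≡ true) (sym (remove-insert p∈W p′))) x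
    removed : Φ W⁻ a x ≡ Φ W a x +ℚ others
    removed = begin
      Φ W⁻ a x
        ≡⟨ Φ-split (updateAt-updates p W) ⟩
      ∑[ c < suc m ] Φ (W⁻ [ p ]≔ true) (a [ p ]≔ c) x
        ≡⟨ sum-remove {i = a p} (λ c → Φ (W⁻ [ p ]≔ true) (a [ p ]≔ c) x) ⟩
      Φ (W⁻ [ p ]≔ true) (a [ p ]≔ a p) x +ℚ ∑[ j < m ] Φ (W⁻ [ p ]≔ true) (a [ p ]≔ punchIn (a p) j) x
        ≡⟨ cong₂ _+ℚ_ (trans restore (Φ-local (λ p′ _ → updateAt-id-local p a refl p′) x))
                      (sum-cong-≗ {m} λ j → restore) ⟩
      Φ W a x +ℚ others ∎

  Φ-∈-span-reduced : (S : Subset n r) (P : List (Fin (n * r))) {W : Subset n r} (b : X n r (suc m)) →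
                     W ⊆ S → (_∈ᵇ W) ⊆ (BelowTop ∘ b) ∪ P → Span (Φ-reduced S) (Φ W b)
  Φ-∈-span-reduced S [] {W} b W⊆S W⊆top∪[] = span-gen (W , b , W⊆S , ⊆∪-[] W⊆top∪[])
  Φ-∈-span-reduced S (p ∷ P) {W} b W⊆S W⊆top∪pP with W p in W[p] | below-top? (b p)
  ... | false | _ = Φ-∈-span-reduced S P b W⊆S
    (⊆∪-uncons W⊆top∪pP (λ p∈W → contradiction p∈W (∉ᵇ {W = W} W[p])) λ _ _ x∈W → x∈W , id)
  ... | true | yes below = Φ-∈-span-reduced S P b W⊆S
    (⊆∪-uncons W⊆top∪pP (λ _ → below) λ _ _ x∈W → x∈W , id)
  ... | true | no top = span-resp (λ x → Φ-exclude W[p]) (span-− removed (span-∑ _ recoloured))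
    where
    removed : Span (Φ-reduced S) (Φ (W [ p ]≔ false) b)
    removed = Φ-∈-span-reduced S P b (λ x → W⊆S x ∘ remove-⊆ x)
      (⊆∪-uncons W⊆top∪pP (λ p∈W⁻ → contradiction p∈W⁻ (∉ᵇ {W = W [ p ]≔ false} (updateAt-updates p W)))
        λ x x≢p x∈W⁻ → remove-⊆ x x∈W⁻ , id)
    recoloured : ∀ j → Span (Φ-reduced S) (Φ W (b [ p ]≔ punchIn (b p) j))
    recoloured j = Φ-∈-span-reduced S P (b [ p ]≔ punchIn (b p) j) W⊆S
      (⊆∪-uncons W⊆top∪pP
        (λ _ → subst BelowTop (sym (updateAt-updates p b)) (below-top-of-≢ top (punchInᵢ≢i (b p) j)))
        λ x x≢p x∈W → x∈W , subst BelowTop (sym (updateAt-minimal x p b x≢p)))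

lemma3p1 : (q n r t : ℕ) → 1 ≤ n → 1 ≤ r → 2 ≤ q → 1 ≤ t → t ≤ n * r →
    ((b : F'Index n r q t) → InSpan {n} {r} {q} (φF {n} {r} {q} {t}) (φF' b))
    × ((a : FIndex n r q t) → InSpan {n} {r} {q} (φF' {n} {r} {q} {t}) (φF a))
lemma3p1 zero n r t _ _ () _ _
lemma3p1 (suc m) n r t _ _ _ _ _ = reduced⊆full , full⊆reduced
  where
  everywhere : {Q G : Pred (Fin (n * r)) 0ℓ} → Q ⊆ G ∪ allFin (n * r)
  everywhere p _ = inj₂ (∈-allFin p)

  reduced⊆full : (b : F'Index n r (suc m) t) → InSpan {n} {r} {suc m} (φF {n} {r} {suc m} {t}) (φF' b)
  reduced⊆full (W , b , (tv , adm , W⊆S) , _) =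
    span-reindex (λ a → tv , adm , a)
      (Indicators.Φ-∈-span-extensions n r (suc m) (prefixSet n r tv) (allFin (n * r)) b W⊆S everywhere)

  full⊆reduced : (a : FIndex n r (suc m) t) → InSpan {n} {r} {suc m} (φF' {n} {r} {suc m} {t}) (φF a)
  full⊆reduced (tv , adm , a) =
    span-reindex (λ (W , b , W⊆S , reduced) → W , b , (tv , adm , W⊆S) , reduced)
      (TopColour.Φ-∈-span-reduced n r m (prefixSet n r tv) (allFin (n * r)) a (λ _ → id) everywhere)
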